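{- Let $D=(V_1,V_2;A)$ be a split digraph such that every vertex of $V_1$ has out-degree and in-degree at least $3$ in $D$. Let $D^{*}$ be any directed multigraph obtained from $D$ by splitting off some pairs at vertices of $V_1$. If $D^{*}\langle V_2\rangle$ is isomorphic to one of $S_4,S_{4,1},S_{4,2},S_{4,3}$, then $D$ has a strong arc decomposition.
   Context: Digraphs have no loops and no parallel arcs; directed multigraphs may have parallel arcs but no loops. A digraph is semicomplete if every two distinct vertices are joined by at least one arc. A split digraph $D=(V_1,V_2;A)$ is a digraph whose vertex set is the disjoint union of two non-empty sets $V_1,V_2$ such that $V_1$ is independent and the subdigraph induced by $V_2$ is semicomplete. For $t\in V_1$ and arcs $ut,tv$ with $u\neq v$, splitting off the pair $(ut,tv)$ at $t$ means replacing the arcs $ut,tv$ by a new arc $uv$ (an additional parallel copy if $uv$ already exists); different split pairs use distinct arcs. $D^{*}\langle V_2\rangle$ is the directed multigraph induced by $V_2$ in $D^{*}$. A directed multigraph is strong if there is a directed path from $x$ to $y$ for every ordered pair of distinct vertices; a strong arc decomposition of $(V,A)$ is a partition of $A$ into $A_1,A_2$ with $(V,A_1),(V,A_2)$ both strong. $S_4$ is the digraph on $\{v_1,v_2,v_3,v_4\}$ with arcs $v_1v_2,v_2v_3,v_3v_4,v_4v_1,v_1v_3,v_3v_1,v_2v_4,v_4v_2$; $S_{4,1}$ is $S_4$ with one extra parallel copy of $v_3v_1$; $S_{4,2}$ is $S_4$ with one extra parallel copy of $v_1v_2$; $S_{4,3}$ is $S_4$ with one extra parallel copy of each of $v_3v_1$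 and $v_2v_4$. -}

module Defs where

open import Data.Nat using (ℕ; _≥_)
open import Data.Bool using (Bool; true; false; not; _∧_; T)
open import Data.Fin using (Fin; zero; suc; _≟_)
open import Data.Product using (_×_; _,_; proj₁; proj₂; ∃; ∃-syntax; Σ-syntax)
import Data.Product as P
open import Data.Sum using (_⊎_)
open import Data.Empty using (⊥)
open import Data.List using (List; []; _∷_; _++_; length; filter; map; concatMap)
open import Data.List.Membership.Propositional using (_∈_)
open import Data.List.Relation.Unary.Unique.Propositional using (Unique)
open import Data.List.Relation.Unary.All using (All)
open import Data.List.Relation.Binary.Permutation.Propositional using (_↭_)
open import Relation.Binary.PropositionalEquality using (_≡_; _≢_)
open import Relation.Nullary.Decidable using (T?)
open import Function.Definitions using (Injective)

Arc : ℕ → Set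
Arc n = Fin n × Fin n

-- A directed multigraph on Fin n is given by a list of arcs (repeated
-- entries = parallel arcs). No loops:
Loopless : ∀ {n} → List (Arc n) → Set
Loopless A = All (λ a → proj₁ a ≢ proj₂ a) A

data Reach {n} (A : List (Arc n)) : Fin n → Fin n → Set where
  here  : ∀ {x} → Reach A x x
  there : ∀ {x y z} → (x , z) ∈ A → Reach A z y → Reach A x y

Strong : ∀ {n} → List (Arc n) → Set
Strong {n} A = (x y : Fin n) → x ≢ y → Reach A x y

HasStrongArcDecomposition : ∀ {n} → List (Arc n) → Set
HasStrongArcDecomposition {n} A =
  Σ[ A₁ ∈ List (Arc n) ] Σ[ A₂ ∈ List (Arc n) ]
    (A ↭ (A₁ ++ A₂)) × Strong A₁ × Strong A₂

outdeg indeg : ∀ {n} → List (Arc n) → Fin n → ℕ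
outdeg A v = length (filter (λ a → proj₁ a ≟ v) A)
indeg  A v = length (filter (λ a → proj₂ a ≟ v) A)

-- A split digraph D = (V₁,V₂;A) on Fin n: inV1 v ≡ true iff v ∈ V₁,
-- and V₂ is the complement.
record SplitDigraph (n : ℕ) : Set where
  field
    inV1       : Fin n → Bool
    arcs       : List (Arc n)
    loopless   : Loopless arcs
    noParallel : Unique arcs
    V1-nonempty : ∃[ v ] inV1 v ≡ true
    V2-nonempty : ∃[ v ] inV1 v ≡ false
    V1-independent : ∀ {u v} → (u , v) ∈ arcs → inV1 u ≡ true → inV1 v ≡ true → ⊥
    V2-semicomplete : ∀ u v → inV1 u ≡ false → inV1 v ≡ false → u ≢ v →
                      ((u , v) ∈ arcs) ⊎ ((v , u) ∈ arcs)

open SplitDigraph public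

-- A splitting-off at vertices of V₁: a list of triples (u , t , v), each
-- standing for splitting off the pair (ut , tv) at t ∈ V₁ with u ≠ v,
-- ut and tv arcs of D, and distinct split pairs using distinct arcs
-- (all the arcs ut, tv used, over all triples, are pairwise distinct).
Triple : ℕ → Set
Triple n = Fin n × Fin n × Fin n

usedArcs : ∀ {n} → List (Triple n) → List (Arc n)
usedArcs = concatMap (λ { (u , t , v) → (u , t) ∷ (t , v) ∷ [] })

record Splitting {n} (D : SplitDigraph n) : Set where
  field
    pairs : List (Triple n)
    valid : All (λ { (u , t , v) → (inV1 D t ≡ true) × (u ≢ v)
                     × ((u , t) ∈ arcs D) × ((t , v) ∈ arcs D) }) pairs
    distinctArcs : Unique (usedArcs pairs)

open Splitting public

-- Arc multiset of D*⟨V₂⟩: arcs of D with both ends in V₂ (these are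
-- untouched by splitting, which only removes arcs incident to V₁),
-- together with one new arc uv for each split pair (ut , tv).
inV2Arc : ∀ {n} → SplitDigraph n → Arc n → Bool
inV2Arc D (u , v) = not (inV1 D u) ∧ not (inV1 D v)

D*⟨V2⟩ : ∀ {n} (D : SplitDigraph n) → Splitting D → List (Arc n)
D*⟨V2⟩ D S = filter (λ a → T? (inV2Arc D a)) (arcs D)
              ++ map (λ { (u , t , v) → (u , v) }) (pairs S)

-- Isomorphism between D*⟨V₂⟩ (a multigraph on the vertex set V₂ ⊆ Fin n)
-- and a multigraph H on Fin 4: a bijection σ : Fin 4 → V₂ carrying the
-- arc multiset of H onto that of D*⟨V₂⟩.
IsoV2 : ∀ {n} (D : SplitDigraph n) → List (Arc n) → List (Arc 4) → Set
IsoV2 {n} D B H =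
  Σ[ σ ∈ (Fin 4 → Fin n) ]
    Injective _≡_ _≡_ σ
    × (∀ i → inV1 D (σ i) ≡ false)
    × (∀ v → inV1 D v ≡ false → ∃[ i ] σ i ≡ v)
    × (B ↭ map (λ { (x , y) → (σ x , σ y) }) H)

v₁ v₂ v₃ v₄ : Fin 4
v₁ = zero
v₂ = suc zero
v₃ = suc (suc zero)
v₄ = suc (suc (suc zero))

S4 S41 S42 S43 : List (Arc 4)
S4 = (v₁ , v₂) ∷ (v₂ , v₃) ∷ (v₃ , v₄) ∷ (v₄ , v₁)
   ∷ (v₁ , v₃) ∷ (v₃ , v₁) ∷ (v₂ , v₄) ∷ (v₄ , v₂) ∷ []
S41 = S4 ++ (v₃ , v₁) ∷ []
S42 = S4 ++ (v₁ , v₂) ∷ []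
S43 = S4 ++ (v₃ , v₁) ∷ (v₂ , v₄) ∷ []

-- Label V₂ by σ so that the 4-cycle σ v₁ → σ v₂ → σ v₃ → σ v₄ → σ v₁ of S₄ lies in D (its reverse
-- arcs are not in S₄, so semicompleteness forces it) and every diagonal arc of S₄ is an arc of D or
-- a 2-path through V₁.  The variants S₄,ᵢ only add parallel arcs, so only the arc set of S₄ matters.
-- Rotating the labelling we may assume σ v₁ → σ v₃ and σ v₂ → σ v₄ are arcs: call σ v₁, σ v₂ heads
-- and σ v₃, σ v₄ tails.  A vertex t ∈ V₁ has in- and out-degree ≥ 3 into the four vertices of V₂,
-- so some diagonal lies inside its in-neighbourhood and some inside its out-neighbourhood.  H₁ is
-- the 4-cycle plus, at every t ∈ V₁, the arc from the head of the first and the arc to the tail of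
-- the second; it is strong.  H₂ is the rest.  Since H₁ never uses an arc from a tail into V₁ or from
-- V₁ into a head, H₂ keeps both diagonal arcs and the 2-paths realising the reverse diagonals, so
-- each diagonal is strongly connected in H₂; and every t ∈ V₁ keeps an H₂ in- and out-neighbour in
-- each diagonal, which links the two diagonals and the whole of V₁.

module Submission where

open import Defs
open import Data.Nat using (_≤_; _≥_; z≤n; s≤s)
open import Data.Nat.Properties using (≤⇒≯)
open import Data.Bool using (Bool; true; false; T)
import Data.Bool as Bool
open import Data.Fin using (Fin; zero; suc; _≟_)
open import Data.Fin.Properties using (all?; any?)
open import Data.Sum using (_⊎_; inj₁; inj₂)
import Data.Sum as Sum
open import Data.Product using (_×_; _,_; proj₁; proj₂; ∃-syntax)
open import Data.Product.Properties using (≡-dec; ,-injectiveˡ; ,-injectiveʳ)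
open import Data.Empty using (⊥-elim)
open import Data.List using (List; []; _∷_; _++_; length; filter)
open import Data.List.Properties using (partition-defn)
open import Data.List.Relation.Unary.Any using (here; there)
open import Data.List.Relation.Unary.AllPairs using (_∷_)
open import Data.List.Relation.Unary.All using (_∷_)
import Data.List.Relation.Unary.All as All
open import Data.List.Membership.Propositional using (_∈_; _∉_)
open import Data.List.Membership.Propositional.Properties using (∈-filter⁺; ∈-filter⁻; ∈-map⁺; ∈-map⁻; ∈-++⁺ˡ; ∈-++⁻)
open import Data.List.Relation.Binary.Subset.Propositional using (_⊆_)
open import Data.List.Relation.Unary.Unique.Propositional using (Unique)
open import Data.List.Relation.Unary.Unique.Propositional.Properties using (filter⁺)
open import Data.List.Relation.Binary.Permutation.Propositional using (_↭_; ↭-sym; ↭ₛ⇒↭)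
open import Data.List.Relation.Binary.Permutation.Propositional.Properties using (∈-resp-↭)
open import Relation.Binary.PropositionalEquality using (_≡_; _≢_; refl; sym; cong; subst; setoid)
open import Function using (_∘_)
open import Relation.Nullary using (yes; no; ¬_)
open import Relation.Nullary.Decidable using (from-yes; ¬?; _→-dec_; _⊎-dec_; _×-dec_)
open import Relation.Unary using (Pred; Decidable)
open import Relation.Unary.Properties using (∁?)
open import Function.Definitions using (Injective)

module _ {n} {A : List (Arc n)} where

  arc : ∀ {x y} → (x , y) ∈ A → Reach A x y
  arc x→y = there x→y here

  infixr 5 _◅◅_
  _◅◅_ : ∀ {x y z} → Reach A x y → Reach A y z → Reach A x z
  here          ◅◅ q = q
  there x→w w↝y ◅◅ q = there x→w (w↝y ◅◅ q)

  strong-via-core : (outside : Fin n → Bool) →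
    (∀ {u v} → outside u ≡ false → outside v ≡ false → Reach A u v) →
    (∀ {t} → outside t ≡ true → ∃[ u ] outside u ≡ false × (u , t) ∈ A) →
    (∀ {t} → outside t ≡ true → ∃[ v ] outside v ≡ false × (t , v) ∈ A) →
    Strong A
  strong-via-core outside connected enter leave x y _ =
    let u , u∈core , x↝u = to-core x
        v , v∈core , v↝y = from-core y
    in  x↝u ◅◅ connected u∈core v∈core ◅◅ v↝y
    where
    to-core : ∀ x → ∃[ u ] outside u ≡ false × Reach A x u
    to-core x with outside x in x∈core
    ... | false = x , x∈core , here
    ... | true  = let u , u∈core , x→u = leave x∈core in u , u∈core , arc x→u

    from-core : ∀ y → ∃[ v ] outside v ≡ false × Reach A v y
    from-core y with outside y in y∈core
    ... | false = y , y∈core , here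
    ... | true  = let v , v∈core , v→y = enter y∈core in v , v∈core , arc v→y

module _ {a ℓ} {X : Set a} {P : Pred X ℓ} (P? : Decidable P) where
  open import Data.List.Relation.Binary.Permutation.Setoid.Properties (setoid X) using (partition-↭)

  filter-∁-↭ : ∀ xs → xs ↭ filter P? xs ++ filter (∁? P?) xs
  filter-∁-↭ xs = subst (λ p → xs ↭ proj₁ p ++ proj₂ p) (partition-defn P? xs) (↭ₛ⇒↭ (partition-↭ P? xs))

next : Fin 4 → Fin 4
next zero                   = v₂
next (suc zero)             = v₃
next (suc (suc zero))       = v₄
next (suc (suc (suc zero))) = v₁

opposite : Fin 4 → Fin 4
opposite i = next (next i)

next-injective : Injective _≡_ _≡_ next
next-injective {i} {j} = from-yes (all? λ (i : Fin 4) → all? λ (j : Fin 4) → next i ≟ next j →-dec i ≟ j) i j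

next-moves : ∀ i → i ≢ next i
next-moves = from-yes (all? λ (i : Fin 4) → ¬? (i ≟ next i))

next-surjective : ∀ i → ∃[ j ] next j ≡ i
next-surjective = from-yes (all? λ (i : Fin 4) → any? λ (j : Fin 4) → next j ≟ i)

cycle-connects : ∀ {n} {H : List (Arc n)} (σ : Fin 4 → Fin n) →
  (∀ i → (σ i , σ (next i)) ∈ H) → ∀ i j → Reach H (σ i) (σ j)
cycle-connects {H = H} σ step i j = to-v₁ i ◅◅ from-v₁ j
  where
  from-v₁ : ∀ j → Reach H (σ v₁) (σ j)
  from-v₁ zero                   = here
  from-v₁ (suc zero)             = arc (step v₁)
  from-v₁ (suc (suc zero))       = arc (step v₁) ◅◅ arc (step v₂)
  from-v₁ (suc (suc (suc zero))) = arc (step v₁) ◅◅ arc (step v₂) ◅◅ arc (step v₃)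
  to-v₁ : ∀ i → Reach H (σ i) (σ v₁)
  to-v₁ zero                   = here
  to-v₁ (suc zero)             = arc (step v₂) ◅◅ arc (step v₃) ◅◅ arc (step v₄)
  to-v₁ (suc (suc zero))       = arc (step v₃) ◅◅ arc (step v₄)
  to-v₁ (suc (suc (suc zero))) = arc (step v₄)

unique⇒length≤2 : ∀ {a} {X : Set a} {y z : X} {xs} → Unique xs →
  (∀ {x} → x ∈ xs → x ≡ y ⊎ x ≡ z) → length xs ≤ 2
unique⇒length≤2 {xs = []}              _ _ = z≤n
unique⇒length≤2 {xs = _ ∷ []}          _ _ = s≤s z≤n
unique⇒length≤2 {xs = _ ∷ _ ∷ []}      _ _ = s≤s (s≤s z≤n)
unique⇒length≤2 {xs = _ ∷ _ ∷ _ ∷ _} ((x₁≢x₂ ∷ x₁≢x₃ ∷ _) ∷ (x₂≢x₃ ∷ _) ∷ _) ⊆yz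
  with ⊆yz (here refl) | ⊆yz (there (here refl)) | ⊆yz (there (there (here refl)))
... | inj₁ refl | inj₁ refl | _         = ⊥-elim (x₁≢x₂ refl)
... | inj₂ refl | inj₂ refl | _         = ⊥-elim (x₁≢x₂ refl)
... | inj₁ refl | _         | inj₁ refl = ⊥-elim (x₁≢x₃ refl)
... | inj₂ refl | _         | inj₂ refl = ⊥-elim (x₁≢x₃ refl)
... | _         | inj₁ refl | inj₁ refl = ⊥-elim (x₂≢x₃ refl)
... | _         | inj₂ refl | inj₂ refl = ⊥-elim (x₂≢x₃ refl)

two-others : (i j : Fin 4) → i ≢ j → ∃[ k ] ∃[ l ] ∀ m → m ≢ i → m ≢ j → m ≡ k ⊎ m ≡ l
two-others = from-yes (all? λ (i : Fin 4) → all? λ (j : Fin 4) → ¬? (i ≟ j) →-dec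
  any? λ (k : Fin 4) → any? λ (l : Fin 4) →
  all? λ (m : Fin 4) → ¬? (m ≟ i) →-dec ¬? (m ≟ j) →-dec (m ≟ k ⊎-dec m ≟ l))

length≤2-avoiding : ∀ {a} {X : Set a} (f : Fin 4 → X) {i j} {xs : List X} → i ≢ j → Unique xs →
  (∀ {x} → x ∈ xs → ∃[ m ] m ≢ i × m ≢ j × x ≡ f m) → length xs ≤ 2
length≤2-avoiding f {i} {j} {xs} i≢j uniq ⊆f with two-others i j i≢j
... | k , l , others = unique⇒length≤2 uniq ⊆fkl
  where
  ⊆fkl : ∀ {x} → x ∈ xs → x ≡ f k ⊎ x ≡ f l
  ⊆fkl x∈ with ⊆f x∈
  ... | m , m≢i , m≢j , refl = Sum.map (cong f) (cong f) (others m m≢i m≢j)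

module _ {n} (D : SplitDigraph n) where

  open import Data.List.Membership.DecPropositional (≡-dec (_≟_ {n}) (_≟_ {n})) using (_∈?_)

  Realised : Fin n → Fin n → Set
  Realised u v = (u , v) ∈ arcs D ⊎ ∃[ t ] inV1 D t ≡ true × (u , t) ∈ arcs D × (t , v) ∈ arcs D

  in-neighbour∈V₂ : ∀ {u t} → (u , t) ∈ arcs D → inV1 D t ≡ true → inV1 D u ≡ false
  in-neighbour∈V₂ {u} u→t t∈V₁ with inV1 D u in u∈V₁
  ... | true  = ⊥-elim (V1-independent D u→t u∈V₁ t∈V₁)
  ... | false = refl

  out-neighbour∈V₂ : ∀ {t v} → (t , v) ∈ arcs D → inV1 D t ≡ true → inV1 D v ≡ false
  out-neighbour∈V₂ {v = v} t→v t∈V₁ with inV1 D v in v∈V₁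
  ... | true  = ⊥-elim (V1-independent D t→v t∈V₁ v∈V₁)
  ... | false = refl

  V₂-arc∈D* : ∀ (S : Splitting D) {u v} → (u , v) ∈ arcs D →
    inV1 D u ≡ false → inV1 D v ≡ false → (u , v) ∈ D*⟨V2⟩ D S
  V₂-arc∈D* S u→v u∈V₂ v∈V₂ = ∈-++⁺ˡ (∈-filter⁺ _ u→v (inV2Arc-true u∈V₂ v∈V₂))
    where
    inV2Arc-true : ∀ {u v} → inV1 D u ≡ false → inV1 D v ≡ false → T (inV2Arc D (u , v))
    inV2Arc-true u∈V₂ v∈V₂ rewrite u∈V₂ | v∈V₂ = _

  D*-arc-realised : ∀ (S : Splitting D) {u v} → (u , v) ∈ D*⟨V2⟩ D S → Realised u v
  D*-arc-realised S uv∈ with ∈-++⁻ (filter _ (arcs D)) uv∈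
  ... | inj₁ kept = inj₁ (proj₁ (∈-filter⁻ _ kept))
  ... | inj₂ new with ∈-map⁻ _ new
  ...   | _ , pair∈ , refl with All.lookup (valid S) pair∈
  ...     | t∈V₁ , _ , u→t , t→v = inj₂ (_ , t∈V₁ , u→t , t→v)

  module _ {σ : Fin 4 → Fin n} (onto-V₂ : ∀ v → inV1 D v ≡ false → ∃[ m ] σ m ≡ v)
           {t} (t∈V₁ : inV1 D t ≡ true) where

    indeg≥3⇒all-but-one-in : indeg (arcs D) t ≥ 3 → ∀ {i j} → i ≢ j → (σ i , t) ∈ arcs D ⊎ (σ j , t) ∈ arcs D
    indeg≥3⇒all-but-one-in deg {i} {j} i≢j with (σ i , t) ∈? arcs D | (σ j , t) ∈? arcs D
    ... | yes i→t | _       = inj₁ i→t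
    ... | no _    | yes j→t = inj₂ j→t
    ... | no i↛t  | no j↛t  =
      ⊥-elim (≤⇒≯ (length≤2-avoiding (λ m → σ m , t) i≢j (filter⁺ _ (noParallel D)) in-arc) deg)
      where
      in-arc : ∀ {e} → e ∈ filter (λ a → proj₂ a ≟ t) (arcs D) → ∃[ m ] m ≢ i × m ≢ j × e ≡ (σ m , t)
      in-arc {u , _} e∈ with ∈-filter⁻ (λ a → proj₂ a ≟ t) e∈
      ... | u→t , refl with onto-V₂ u (in-neighbour∈V₂ u→t t∈V₁)
      ...   | m , refl = m , (λ { refl → i↛t u→t }) , (λ { refl → j↛t u→t }) , refl

    outdeg≥3⇒all-but-one-out : outdeg (arcs D) t ≥ 3 → ∀ {i j} → i ≢ j → (t , σ i) ∈ arcs D ⊎ (t , σ j) ∈ arcs D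
    outdeg≥3⇒all-but-one-out deg {i} {j} i≢j with (t , σ i) ∈? arcs D | (t , σ j) ∈? arcs D
    ... | yes t→i | _       = inj₁ t→i
    ... | no _    | yes t→j = inj₂ t→j
    ... | no t↛i  | no t↛j  =
      ⊥-elim (≤⇒≯ (length≤2-avoiding (λ m → t , σ m) i≢j (filter⁺ _ (noParallel D)) out-arc) deg)
      where
      out-arc : ∀ {e} → e ∈ filter (λ a → proj₁ a ≟ t) (arcs D) → ∃[ m ] m ≢ i × m ≢ j × e ≡ (t , σ m)
      out-arc {_ , v} e∈ with ∈-filter⁻ (λ a → proj₁ a ≟ t) e∈
      ... | t→v , refl with onto-V₂ v (out-neighbour∈V₂ t→v t∈V₁)
      ...   | m , refl = m , (λ { refl → t↛i t→v }) , (λ { refl → t↛j t→v }) , refl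

record S4Frame {n} (D : SplitDigraph n) (σ : Fin 4 → Fin n) : Set where
  field
    injective       : Injective _≡_ _≡_ σ
    into-V₂         : ∀ i → inV1 D (σ i) ≡ false
    onto-V₂         : ∀ v → inV1 D v ≡ false → ∃[ i ] σ i ≡ v
    cycle           : ∀ i → (σ i , σ (next i)) ∈ arcs D
    chord           : ∀ i → Realised D (σ i) (σ (opposite i))
    all-but-one-in  : ∀ {t} → inV1 D t ≡ true → ∀ {i j} → i ≢ j → (σ i , t) ∈ arcs D ⊎ (σ j , t) ∈ arcs D
    all-but-one-out : ∀ {t} → inV1 D t ≡ true → ∀ {i j} → i ≢ j → (t , σ i) ∈ arcs D ⊎ (t , σ j) ∈ arcs D

module _ {n} {D : SplitDigraph n} where

  rotate : ∀ {σ} → S4Frame D σ → S4Frame D (σ ∘ next)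
  rotate {σ} F = record
    { injective       = next-injective ∘ injective
    ; into-V₂         = into-V₂ ∘ next
    ; onto-V₂         = onto-V₂′
    ; cycle           = cycle ∘ next
    ; chord           = chord ∘ next
    ; all-but-one-in  = λ t∈V₁ i≢j → all-but-one-in t∈V₁ (i≢j ∘ next-injective)
    ; all-but-one-out = λ t∈V₁ i≢j → all-but-one-out t∈V₁ (i≢j ∘ next-injective)
    }
    where
    open S4Frame F
    onto-V₂′ : ∀ v → inV1 D v ≡ false → ∃[ i ] σ (next i) ≡ v
    onto-V₂′ v v∈V₂ with onto-V₂ v v∈V₂
    ... | i , refl with next-surjective i
    ...   | j , refl = j , refl

  joined : ∀ {σ} → S4Frame D σ → ∀ {i j} → i ≢ j → (σ i , σ j) ∈ arcs D ⊎ (σ j , σ i) ∈ arcs D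
  joined {σ} F {i} {j} i≢j = V2-semicomplete D (σ i) (σ j) (into-V₂ i) (into-V₂ j) (i≢j ∘ injective)
    where open S4Frame F

  orient : ∀ {σ} → S4Frame D σ →
    ∃[ τ ] S4Frame D τ × (τ v₁ , τ v₃) ∈ arcs D × (τ v₂ , τ v₄) ∈ arcs D
  orient F with joined F {v₁} {v₃} (λ ()) | joined F {v₂} {v₄} (λ ())
  ... | inj₁ ac | inj₁ bd = _ , F , ac , bd
  ... | inj₂ ca | inj₁ bd = _ , rotate F , bd , ca
  ... | inj₂ ca | inj₂ db = _ , rotate (rotate F) , ca , db
  ... | inj₁ ac | inj₂ db = _ , rotate (rotate (rotate F)) , db , ac

module Decomposition {n} (D : SplitDigraph n) {σ : Fin 4 → Fin n} (F : S4Frame D σ)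
  (ac∈A : (σ v₁ , σ v₃) ∈ arcs D) (bd∈A : (σ v₂ , σ v₄) ∈ arcs D) where

  open S4Frame F
  open import Data.List.Membership.DecPropositional (≡-dec (_≟_ {n}) (_≟_ {n})) using (_∈?_)

  A : List (Arc n)
  A = arcs D

  true≢false : ∀ {b} → b ≡ true → b ≢ false
  true≢false refl ()

  all-in-but : ∀ {t} → inV1 D t ≡ true → ∀ {i j} → (σ i , t) ∉ A → j ≢ i → (σ j , t) ∈ A
  all-in-but t∈V₁ i↛t j≢i = Sum.[ (λ i→t → ⊥-elim (i↛t i→t)) , (λ j→t → j→t) ]′ (all-but-one-in t∈V₁ (j≢i ∘ sym))

  all-out-but : ∀ {t} → inV1 D t ≡ true → ∀ {i j} → (t , σ i) ∉ A → j ≢ i → (t , σ j) ∈ A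
  all-out-but t∈V₁ t↛i j≢i = Sum.[ (λ t→i → ⊥-elim (t↛i t→i)) , (λ t→j → t→j) ]′ (all-but-one-out t∈V₁ (j≢i ∘ sym))

  data Diagonal : Set where
    ac bd : Diagonal

  headIx tailIx : Diagonal → Fin 4
  headIx ac = v₁
  headIx bd = v₂
  tailIx ac = v₃
  tailIx bd = v₄

  head tail : Diagonal → Fin n
  head X = σ (headIx X)
  tail X = σ (tailIx X)

  _∈ᴰ_ : Fin n → Diagonal → Set
  x ∈ᴰ X = x ≡ head X ⊎ x ≡ tail X

  headIx≢tailIx : ∀ X Y → headIx X ≢ tailIx Y
  headIx≢tailIx ac ac ()
  headIx≢tailIx ac bd ()
  headIx≢tailIx bd ac ()
  headIx≢tailIx bd bd ()

  head≢tail : ∀ X Y → head X ≢ tail Y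
  head≢tail X Y = headIx≢tailIx X Y ∘ injective

  head-injective : ∀ {X Y} → head X ≡ head Y → X ≡ Y
  head-injective {ac} {ac} _ = refl
  head-injective {bd} {bd} _ = refl
  head-injective {ac} {bd} eq with () ← injective eq
  head-injective {bd} {ac} eq with () ← injective eq

  tail-injective : ∀ {X Y} → tail X ≡ tail Y → X ≡ Y
  tail-injective {ac} {ac} _ = refl
  tail-injective {bd} {bd} _ = refl
  tail-injective {ac} {bd} eq with () ← injective eq
  tail-injective {bd} {ac} eq with () ← injective eq

  diagonal-of : ∀ i → ∃[ X ] σ i ∈ᴰ X
  diagonal-of zero                   = ac , inj₁ refl
  diagonal-of (suc zero)             = bd , inj₁ refl
  diagonal-of (suc (suc zero))       = ac , inj₂ refl
  diagonal-of (suc (suc (suc zero))) = bd , inj₂ refl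

  ∈ᴰ⇒∈V₂ : ∀ {x X} → x ∈ᴰ X → inV1 D x ≡ false
  ∈ᴰ⇒∈V₂ (inj₁ refl) = into-V₂ _
  ∈ᴰ⇒∈V₂ (inj₂ refl) = into-V₂ _

  diagonal-arc : ∀ X → (head X , tail X) ∈ A
  diagonal-arc ac = ac∈A
  diagonal-arc bd = bd∈A

  reverse-diagonal : ∀ X → Realised D (tail X) (head X)
  reverse-diagonal ac = chord v₃
  reverse-diagonal bd = chord v₄

  fullIn fullOut : Fin n → Diagonal
  fullIn t with (head ac , t) ∈? A | (tail ac , t) ∈? A
  ... | yes _ | yes _ = ac
  ... | _     | _     = bd
  fullOut t with (t , head ac) ∈? A | (t , tail ac) ∈? A
  ... | yes _ | yes _ = ac
  ... | _     | _     = bd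

  fullIn-in : ∀ {t} → inV1 D t ≡ true → ∀ {x} → x ∈ᴰ fullIn t → (x , t) ∈ A
  fullIn-in {t} t∈V₁ with (head ac , t) ∈? A | (tail ac , t) ∈? A
  ... | yes a→t | yes c→t = λ { (inj₁ refl) → a→t ; (inj₂ refl) → c→t }
  ... | no a↛t  | _       = λ { (inj₁ refl) → all-in-but t∈V₁ a↛t (λ ()) ; (inj₂ refl) → all-in-but t∈V₁ a↛t (λ ()) }
  ... | yes _   | no c↛t  = λ { (inj₁ refl) → all-in-but t∈V₁ c↛t (λ ()) ; (inj₂ refl) → all-in-but t∈V₁ c↛t (λ ()) }

  fullOut-out : ∀ {t} → inV1 D t ≡ true → ∀ {y} → y ∈ᴰ fullOut t → (t , y) ∈ A
  fullOut-out {t} t∈V₁ with (t , head ac) ∈? A | (t , tail ac) ∈? A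
  ... | yes t→a | yes t→c = λ { (inj₁ refl) → t→a ; (inj₂ refl) → t→c }
  ... | no t↛a  | _       = λ { (inj₁ refl) → all-out-but t∈V₁ t↛a (λ ()) ; (inj₂ refl) → all-out-but t∈V₁ t↛a (λ ()) }
  ... | yes _   | no t↛c  = λ { (inj₁ refl) → all-out-but t∈V₁ t↛c (λ ()) ; (inj₂ refl) → all-out-but t∈V₁ t↛c (λ ()) }

  keptIn keptOut : Fin n → Fin n
  keptIn t  = head (fullIn t)
  keptOut t = tail (fullOut t)

  IsCycleArc : Arc n → Set
  IsCycleArc (u , v) = ∃[ i ] σ i ≡ u × σ (next i) ≡ v

  InH₁ : Arc n → Set
  InH₁ (u , v) = (inV1 D v ≡ true × u ≡ keptIn v) ⊎ (inV1 D u ≡ true × v ≡ keptOut u) ⊎ IsCycleArc (u , v)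

  InH₁? : Decidable InH₁
  InH₁? (u , v) = (inV1 D v Bool.≟ true ×-dec u ≟ keptIn v) ⊎-dec (inV1 D u Bool.≟ true ×-dec v ≟ keptOut u)
    ⊎-dec any? (λ i → σ i ≟ u ×-dec σ (next i) ≟ v)

  H₁ H₂ : List (Arc n)
  H₁ = filter InH₁? A
  H₂ = filter (∁? InH₁?) A

  keptIn∈H₁ : ∀ {t} → inV1 D t ≡ true → (keptIn t , t) ∈ H₁
  keptIn∈H₁ t∈V₁ = ∈-filter⁺ InH₁? (fullIn-in t∈V₁ (inj₁ refl)) (inj₁ (t∈V₁ , refl))

  keptOut∈H₁ : ∀ {t} → inV1 D t ≡ true → (t , keptOut t) ∈ H₁
  keptOut∈H₁ t∈V₁ = ∈-filter⁺ InH₁? (fullOut-out t∈V₁ (inj₂ refl)) (inj₂ (inj₁ (t∈V₁ , refl)))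

  cycle∈H₁ : ∀ i → (σ i , σ (next i)) ∈ H₁
  cycle∈H₁ i = ∈-filter⁺ InH₁? (cycle i) (inj₂ (inj₂ (i , refl , refl)))

  in-arc∈H₂ : ∀ {x t} → (x , t) ∈ A → inV1 D t ≡ true → x ≢ keptIn t → (x , t) ∈ H₂
  in-arc∈H₂ x→t t∈V₁ x≢kept = ∈-filter⁺ (∁? InH₁?) x→t λ where
    (inj₁ (_ , x≡kept))         → x≢kept x≡kept
    (inj₂ (inj₁ (x∈V₁ , _)))    → true≢false x∈V₁ (in-neighbour∈V₂ D x→t t∈V₁)
    (inj₂ (inj₂ (i , _ , refl))) → true≢false t∈V₁ (into-V₂ (next i))

  out-arc∈H₂ : ∀ {t y} → (t , y) ∈ A → inV1 D t ≡ true → y ≢ keptOut t → (t , y) ∈ H₂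
  out-arc∈H₂ t→y t∈V₁ y≢kept = ∈-filter⁺ (∁? InH₁?) t→y λ where
    (inj₁ (y∈V₁ , _))           → true≢false y∈V₁ (out-neighbour∈V₂ D t→y t∈V₁)
    (inj₂ (inj₁ (_ , y≡kept)))  → y≢kept y≡kept
    (inj₂ (inj₂ (i , refl , _))) → true≢false t∈V₁ (into-V₂ i)

  V₂-arc∈H₂ : ∀ {u v} → (u , v) ∈ A → inV1 D u ≡ false → inV1 D v ≡ false → ¬ IsCycleArc (u , v) → (u , v) ∈ H₂
  V₂-arc∈H₂ u→v u∈V₂ v∈V₂ not-cycle = ∈-filter⁺ (∁? InH₁?) u→v λ where
    (inj₁ (v∈V₁ , _))        → true≢false v∈V₁ v∈V₂
    (inj₂ (inj₁ (u∈V₁ , _))) → true≢false u∈V₁ u∈V₂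
    (inj₂ (inj₂ is-cycle))   → not-cycle is-cycle

  diagonal∉cycle : ∀ X → ¬ IsCycleArc (head X , tail X)
  diagonal∉cycle ac (i , σi≡ , σni≡) with injective σi≡
  ... | refl with () ← injective σni≡
  diagonal∉cycle bd (i , σi≡ , σni≡) with injective σi≡
  ... | refl with () ← injective σni≡

  reverse-diagonal∉cycle : ∀ X → ¬ IsCycleArc (tail X , head X)
  reverse-diagonal∉cycle ac (i , σi≡ , σni≡) with injective σi≡
  ... | refl with () ← injective σni≡
  reverse-diagonal∉cycle bd (i , σi≡ , σni≡) with injective σi≡
  ... | refl with () ← injective σni≡

  diagonal-strong : ∀ X {x y} → x ∈ᴰ X → y ∈ᴰ X → Reach H₂ x y
  diagonal-strong X (inj₁ refl) (inj₁ refl) = here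
  diagonal-strong X (inj₂ refl) (inj₂ refl) = here
  diagonal-strong X (inj₁ refl) (inj₂ refl) =
    arc (V₂-arc∈H₂ (diagonal-arc X) (into-V₂ _) (into-V₂ _) (diagonal∉cycle X))
  diagonal-strong X (inj₂ refl) (inj₁ refl) with reverse-diagonal X
  ... | inj₁ k→h = arc (V₂-arc∈H₂ k→h (into-V₂ _) (into-V₂ _) (reverse-diagonal∉cycle X))
  ... | inj₂ (t , t∈V₁ , k→t , t→h) =
    arc (in-arc∈H₂ k→t t∈V₁ (head≢tail (fullIn t) X ∘ sym))
    ◅◅ arc (out-arc∈H₂ t→h t∈V₁ (head≢tail X (fullOut t)))

  H₂-in-neighbour : ∀ {t} → inV1 D t ≡ true → ∀ X → ∃[ x ] x ∈ᴰ X × (x , t) ∈ H₂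
  H₂-in-neighbour {t} t∈V₁ X with (tail X , t) ∈? A
  ... | yes k→t = tail X , inj₂ refl , in-arc∈H₂ k→t t∈V₁ (head≢tail (fullIn t) X ∘ sym)
  ... | no k↛t  = head X , inj₁ refl , in-arc∈H₂ (all-in-but t∈V₁ k↛t (headIx≢tailIx X X)) t∈V₁ h≢kept
    where
    h≢kept : head X ≢ keptIn t
    h≢kept h≡kept = k↛t (fullIn-in t∈V₁ (inj₂ (cong tail (head-injective h≡kept))))

  H₂-out-neighbour : ∀ {t} → inV1 D t ≡ true → ∀ X → ∃[ y ] y ∈ᴰ X × (t , y) ∈ H₂
  H₂-out-neighbour {t} t∈V₁ X with (t , head X) ∈? A
  ... | yes t→h = head X , inj₁ refl , out-arc∈H₂ t→h t∈V₁ (head≢tail X (fullOut t))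
  ... | no t↛h  = tail X , inj₂ refl , out-arc∈H₂ (all-out-but t∈V₁ t↛h (headIx≢tailIx X X ∘ sym)) t∈V₁ k≢kept
    where
    k≢kept : tail X ≢ keptOut t
    k≢kept k≡kept = t↛h (fullOut-out t∈V₁ (inj₁ (cong head (tail-injective k≡kept))))

  H₂-connects-V₂ : ∀ {u v} → inV1 D u ≡ false → inV1 D v ≡ false → Reach H₂ u v
  H₂-connects-V₂ u∈V₂ v∈V₂ with onto-V₂ _ u∈V₂ | onto-V₂ _ v∈V₂
  ... | i , refl | j , refl with diagonal-of i | diagonal-of j
  ... | X , i∈X | Y , j∈Y with V1-nonempty D
  ... | t , t∈V₁ with H₂-in-neighbour t∈V₁ X | H₂-out-neighbour t∈V₁ Y
  ... | x , x∈X , x→t | y , y∈Y , t→y =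
    diagonal-strong X i∈X x∈X ◅◅ arc x→t ◅◅ arc t→y ◅◅ diagonal-strong Y y∈Y j∈Y

  H₁-connects-V₂ : ∀ {u v} → inV1 D u ≡ false → inV1 D v ≡ false → Reach H₁ u v
  H₁-connects-V₂ u∈V₂ v∈V₂ with onto-V₂ _ u∈V₂ | onto-V₂ _ v∈V₂
  ... | i , refl | j , refl = cycle-connects σ cycle∈H₁ i j

  H₁-strong : Strong H₁
  H₁-strong = strong-via-core (inV1 D) H₁-connects-V₂
    (λ t∈V₁ → _ , into-V₂ _ , keptIn∈H₁ t∈V₁)
    (λ t∈V₁ → _ , into-V₂ _ , keptOut∈H₁ t∈V₁)

  H₂-strong : Strong H₂
  H₂-strong = strong-via-core (inV1 D) H₂-connects-V₂
    (λ t∈V₁ → let x , x∈ac , x→t = H₂-in-neighbour t∈V₁ ac in x , ∈ᴰ⇒∈V₂ x∈ac , x→t)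
    (λ t∈V₁ → let y , y∈ac , t→y = H₂-out-neighbour t∈V₁ ac in y , ∈ᴰ⇒∈V₂ y∈ac , t→y)

  decomposition : HasStrongArcDecomposition A
  decomposition = H₁ , H₂ , filter-∁-↭ InH₁? A , H₁-strong , H₂-strong

module _ where
  open import Data.List.Membership.DecPropositional (≡-dec (_≟_ {4}) (_≟_ {4})) using (_∈?_)
  open import Data.List.Relation.Binary.Subset.DecPropositional (≡-dec (_≟_ {4}) (_≟_ {4})) using (_⊆?_)

  reverse-cycle∉S4 : ∀ i → (next i , i) ∉ S4
  reverse-cycle∉S4 = from-yes (all? λ i → ¬? ((next i , i) ∈? S4))

  chord∈S4 : ∀ i → (i , opposite i) ∈ S4
  chord∈S4 = from-yes (all? λ i → (i , opposite i) ∈? S4)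

  S41⊆S4 : S41 ⊆ S4
  S41⊆S4 = from-yes (S41 ⊆? S4)

  S42⊆S4 : S42 ⊆ S4
  S42⊆S4 = from-yes (S42 ⊆? S4)

  S43⊆S4 : S43 ⊆ S4
  S43⊆S4 = from-yes (S43 ⊆? S4)

s4Frame : ∀ {n} (D : SplitDigraph n) →
  (∀ t → inV1 D t ≡ true → (outdeg (arcs D) t ≥ 3) × (indeg (arcs D) t ≥ 3)) →
  (S : Splitting D) {H : List (Arc 4)} → H ⊆ S4 → S4 ⊆ H →
  IsoV2 D (D*⟨V2⟩ D S) H → ∃[ σ ] S4Frame D σ
s4Frame D deg S H⊆S4 S4⊆H (σ , injective , into-V₂ , onto-V₂ , D*↭H) = σ , record
  { injective       = injective
  ; into-V₂         = into-V₂
  ; onto-V₂         = onto-V₂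
  ; cycle           = cycle
  ; chord           = λ i → S4-arc-realised (chord∈S4 i)
  ; all-but-one-in  = λ t∈V₁ → indeg≥3⇒all-but-one-in D onto-V₂ t∈V₁ (proj₂ (deg _ t∈V₁))
  ; all-but-one-out = λ t∈V₁ → outdeg≥3⇒all-but-one-out D onto-V₂ t∈V₁ (proj₁ (deg _ t∈V₁))
  }
  where
  V₂-arc⇒S4 : ∀ {i j} → (σ i , σ j) ∈ arcs D → (i , j) ∈ S4
  V₂-arc⇒S4 σi→σj with ∈-map⁻ _ (∈-resp-↭ D*↭H (V₂-arc∈D* D S σi→σj (into-V₂ _) (into-V₂ _)))
  ... | _ , kl∈H , eq with injective (,-injectiveˡ eq) | injective (,-injectiveʳ eq)
  ...   | refl | refl = H⊆S4 kl∈H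

  S4-arc-realised : ∀ {i j} → (i , j) ∈ S4 → Realised D (σ i) (σ j)
  S4-arc-realised ij∈S4 = D*-arc-realised D S (∈-resp-↭ (↭-sym D*↭H) (∈-map⁺ _ (S4⊆H ij∈S4)))

  cycle : ∀ i → (σ i , σ (next i)) ∈ arcs D
  cycle i with V2-semicomplete D (σ i) (σ (next i)) (into-V₂ _) (into-V₂ _) (next-moves i ∘ injective)
  ... | inj₁ forward  = forward
  ... | inj₂ backward = ⊥-elim (reverse-cycle∉S4 i (V₂-arc⇒S4 backward))

frame⇒strong-arc-decomposition : ∀ {n} {D : SplitDigraph n} {σ} → S4Frame D σ → HasStrongArcDecomposition (arcs D)
frame⇒strong-arc-decomposition {D = D} F with orient F
... | _ , F′ , ac∈A , bd∈A = Decomposition.decomposition D F′ ac∈A bd∈A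

lemma2p7 : ∀ {n} (D : SplitDigraph n) →
    (∀ t → inV1 D t ≡ true → (outdeg (arcs D) t ≥ 3) × (indeg (arcs D) t ≥ 3)) →
    (S : Splitting D) →
    (IsoV2 D (D*⟨V2⟩ D S) S4 ⊎ IsoV2 D (D*⟨V2⟩ D S) S41
      ⊎ IsoV2 D (D*⟨V2⟩ D S) S42 ⊎ IsoV2 D (D*⟨V2⟩ D S) S43) →
    HasStrongArcDecomposition (arcs D)
lemma2p7 D deg S iso = frame⇒strong-arc-decomposition (proj₂ (frame iso))
  where
  frame : IsoV2 D (D*⟨V2⟩ D S) S4 ⊎ IsoV2 D (D*⟨V2⟩ D S) S41
            ⊎ IsoV2 D (D*⟨V2⟩ D S) S42 ⊎ IsoV2 D (D*⟨V2⟩ D S) S43 → ∃[ σ ] S4Frame D σ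
  frame (inj₁ iso)               = s4Frame D deg S (λ e∈ → e∈) (λ e∈ → e∈) iso
  frame (inj₂ (inj₁ iso))        = s4Frame D deg S S41⊆S4 ∈-++⁺ˡ iso
  frame (inj₂ (inj₂ (inj₁ iso))) = s4Frame D deg S S42⊆S4 ∈-++⁺ˡ iso
  frame (inj₂ (inj₂ (inj₂ iso))) = s4Frame D deg S S43⊆S4 ∈-++⁺ˡ iso
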